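{- Let $p$ be an odd prime and $n$ a positive integer. Let $x,y$ be integers with $1\le x\le p-1$, $0\le y\le np-1$ and $1\le x+yp\le np^2-1$. For $1\le i\le p$ put $d_i=(i-1)xpn+x+yp$ and let $R_i\subseteq\mathbb{Z}_{np^3}$ be the set of residues modulo $np^3$ of $$p,\ d_i,\ np^2-d_i,\ np^2+d_i,\ 2np^2-d_i,\ 2np^2+d_i,\ \dots,\ (p-1)np^2-d_i,\ (p-1)np^2+d_i,\ np^3-d_i,\ np^3-p.$$ Then for all $1\le i,j\le p$, $\Theta_{np^3,p,jn}(C_{np^3}(R_i))=C_{np^3}(R_{i+j})$, where the index $i+j$ is reduced modulo $p$ to a value in $\{1,\dots,p\}$; and the $p$ graphs $C_{np^3}(R_1),\dots,C_{np^3}(R_p)$ are Type-2 isomorphic with respect to $p$ (any two with different indices are Type-2 isomorphic with respect to $p$).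
   Context: For a positive integer $N$ and $R\subseteq\mathbb{Z}_N$ with $R=-R$, the circulant graph $C_N(R)$ has vertex set $\mathbb{Z}_N$, with $u,v$ adjacent iff $u-v\in R$. $C_N(R)$ and $C_N(S)$ are Adam's isomorphic if $S=aR \pmod N$ for some $a$ with $\gcd(a,N)=1$. For an integer $r$ with $\gcd(N,r)=m>1$ and $0\le t\le N/m-1$, $\Theta_{N,r,t}:\mathbb{Z}_N\to\mathbb{Z}_N$ is the bijection $u\mapsto u+jtm\pmod N$ where $u=qm+j$, $0\le j\le m-1$; for a graph $G$ on $\mathbb{Z}_N$, $\Theta_{N,r,t}(G)$ is the graph on $\mathbb{Z}_N$ with edges $\{\Theta_{N,r,t}(u),\Theta_{N,r,t}(v)\}$ for edges $\{u,v\}$ of $G$. $C_N(R)$ and $C_N(S)$ are Type-2 isomorphic with respect to $r$ if $R\ne S$, $|R|=|S|\ge 3$, $\Theta_{N,r,t}(C_N(R))=C_N(S)$ for some $1\le t\le N/m-1$, and $S\neq aR\pmod N$ for all $a$ with $\gcd(a,N)=1$. -}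

module Defs where

open import Data.Nat using (ℕ; zero; suc; _+_; _*_; _∸_; _^_; _≤_; _<_; NonZero; ≢-nonZero; nonTrivial⇒nonZero)
open import Data.Nat.Properties using (m*n≢0; m^n≢0)
open import Data.Nat.DivMod using (_%_; _/_; _mod_)
open import Data.Nat.GCD using (gcd; gcd[m,n]≢0)
open import Data.Nat.Coprimality using (Coprime)
open import Data.Nat.Primality using (Prime) renaming (prime⇒nonZero to prime⇒nz)
open import Data.Integer as ℤ using (ℤ; +_)
open import Data.Integer.DivMod using (_%ℕ_)
open import Data.Fin using (Fin; toℕ)
open import Data.Fin.Subset using (Subset; _∈_; ⁅_⁆; _∪_; ∣_∣) renaming (⊥ to ∅)
open import Data.List using (List; []; _∷_; _++_; map; upTo; foldr)
open import Data.Product using (Σ; ∃; ∃₂; _×_; _,_)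
open import Data.Sum using (inj₁)
open import Relation.Binary.PropositionalEquality using (_≡_; _≢_)
open import Relation.Nullary using (¬_)

npc-nz : (p n : ℕ) → {{Prime p}} → {{NonZero n}} → NonZero (n * p ^ 3)
npc-nz p n {{hp}} {{nzn}} = m*n≢0 n (p ^ 3) {{nzn}} {{m^n≢0 p 3 {{prime⇒nz hp}}}}

gcd-nonZero : ∀ N r → {{NonZero N}} → NonZero (gcd N r)
gcd-nonZero (suc N) r = ≢-nonZero (gcd[m,n]≢0 (suc N) r (inj₁ λ ()))

Image : ∀ {N} → (Fin N → Fin N) → (Fin N → Fin N → Set) → Fin N → Fin N → Set
Image f G a b = ∃₂ λ u v → G u v × f u ≡ a × f v ≡ b

GraphEq : ∀ {N} → (Fin N → Fin N → Set) → (Fin N → Fin N → Set) → Set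
GraphEq G H = ∀ a b → (G a b → H a b) × (H a b → G a b)

-- Z_N is represented by Fin N; an integer is sent to its residue.

module _ (N : ℕ) {{_ : NonZero N}} where

  res : ℤ → Fin N
  res z = (z %ℕ N) mod N

  diff : Fin N → Fin N → Fin N
  diff u v = res (+ toℕ u ℤ.- + toℕ v)

  Circ : Subset N → Fin N → Fin N → Set
  Circ R u v = diff u v ∈ R

  Θ : (r t : ℕ) → Fin N → Fin N
  Θ r t u = (toℕ u + (_%_ (toℕ u) (gcd N r) {{gcd-nonZero N r}}) * t * gcd N r) mod N

  InScaled : ℕ → Subset N → Fin N → Set
  InScaled a R s = ∃ λ x → x ∈ R × s ≡ res (+ (a * toℕ x))

  Type2 : (r : ℕ) → Subset N → Subset N → Set
  Type2 r R S =
      R ≢ S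
    × ∣ R ∣ ≡ ∣ S ∣
    × 3 ≤ ∣ R ∣
    × 1 < gcd N r
    × (∃ λ t → 1 ≤ t × t ≤ (N / gcd N r) {{gcd-nonZero N r}} ∸ 1
         × GraphEq (Image (Θ r t) (Circ R)) (Circ S))
    × (∀ a → Coprime a N → ¬ (∀ s → (s ∈ S → InScaled a R s) × (InScaled a R s → s ∈ S)))

d : (p n x y i : ℕ) → ℕ
d p n x y i = (i ∸ 1) * x * p * n + x + y * p

Rlist : (p n x y i : ℕ) → List ℤ
Rlist p n x y i =
  + p
  ∷ map (λ k → + (di + k * (n * p ^ 2))) (upTo p)
  ++ map (λ k → + (suc k * (n * p ^ 2)) ℤ.- + di) (upTo p)
  ++ (+ (n * p ^ 3) ℤ.- + p) ∷ []
  where di = d p n x y i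

Rset : (p n x y i : ℕ) → {{Prime p}} → {{NonZero n}} → Subset (n * p ^ 3)
Rset p n x y i = foldr (λ z S → ⁅ res (n * p ^ 3) {{npc-nz p n}} z ⁆ ∪ S) ∅ (Rlist p n x y i)

-- reduce an index k ≥ 1 modulo p to a value in {1, …, p}
-- (p is a prime here; primality only supplies p ≠ 0)
wrap : (p : ℕ) → {{Prime p}} → ℕ → ℕ
wrap p {{hp}} k = suc (_%_ (k ∸ 1) p {{prime⇒nz hp}})

{-# OPTIONS --safe #-}
module Submission where

-- Write M = np² and N = np³ = pM. Modulo N the set R_i consists of ±p and of all residues
-- congruent to ±d_i modulo M. For t = jn the map Θ moves a vertex u by (u mod p)·jnp, so it
-- changes a difference D = u − v by c·jnp, where c = (u mod p) − (v mod p) ≡ D (mod p).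
-- If D ≡ ±p then p ∣ c, so c = 0 and D is unchanged; if D ≡ ±d_i (mod M) then c ≡ ±x (mod p)
-- and the change is ±xjnp (mod M), which is d_{i+j} − d_i. As Θ_{jn} is a bijection (inverted
-- by Θ_{(M−1)jn}), this gives Θ(C(R_i)) = C(R_{i+j}).
--
-- For the Type-2 claims: Θ injects every R_i into every R_j, so the |R_i| agree, and p, d_i, −d_i
-- are three distinct elements. As p ∤ x and p is odd, d_i ≢ ±d_j (mod M) for i ≠ j, so R_i ≠ R_j;
-- and a unit a with aR_i = R_j sends p to ±p, forcing a ≡ ±1 (mod M) and then d_j ≡ ±ad_i ≡ ±d_i
-- (mod M), which is impossible.

open import Defs
open import Data.Nat as ℕ using (ℕ; zero; suc; _∸_; _^_; _≤_; _<_; z≤n; s≤s; NonZero)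
import Data.Nat.Properties as ℕ
import Data.Nat.Divisibility as ℕ
open import Data.Nat.DivMod using (_%_; _/_)
open import Data.Nat.Primality using (Prime; euclidsLemma)
open import Data.Fin using (Fin; zero; suc; toℕ)
open import Data.Fin.Subset using (Subset; _∈_; ⁅_⁆; _∪_) renaming (⊥ to ∅)
open import Data.Fin.Subset.Properties using (x∈p∪q⁻; x∈p∪q⁺; x∈⁅y⁆⇒x≡y; x∈⁅x⁆; ∉⊥)
open import Data.List using (List; []; _∷_; foldr)
open import Data.List.Relation.Unary.Any using (Any; here; there)
open import Data.Product using (∃; _×_; _,_; proj₁; proj₂)
open import Data.Sum as Sum using (_⊎_; inj₁; inj₂)
open import Data.Vec as Vec using (_∷_)
open import Function.Definitions using (Injective)
open import Relation.Nullary using (¬_; yes; no; contradiction)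
open import Relation.Binary.PropositionalEquality
open import Function using (_∘_)
import Relation.Binary.Reasoning.Setoid

image : ∀ {A : Set} {n} → (A → Fin n) → List A → Subset n
image g = foldr (λ a S → ⁅ g a ⁆ ∪ S) ∅

module _ {A : Set} {n} (g : A → Fin n) where

  ∈-image⁻ : ∀ xs {y} → y ∈ image g xs → Any (λ a → y ≡ g a) xs
  ∈-image⁻ [] y∈ = contradiction y∈ ∉⊥
  ∈-image⁻ (a ∷ xs) y∈ with x∈p∪q⁻ ⁅ g a ⁆ (image g xs) y∈
  ... | inj₁ y∈⁅ga⁆ = here (x∈⁅y⁆⇒x≡y (g a) y∈⁅ga⁆)
  ... | inj₂ y∈rest = there (∈-image⁻ xs y∈rest)

  ∈-image⁺ : ∀ xs {y} → Any (λ a → y ≡ g a) xs → y ∈ image g xs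
  ∈-image⁺ (a ∷ xs) (here refl) = x∈p∪q⁺ (inj₁ (x∈⁅x⁆ (g a)))
  ∈-image⁺ (a ∷ xs) (there y∈) = x∈p∪q⁺ {p = ⁅ g a ⁆} (inj₂ (∈-image⁺ xs y∈))

module SubsetCardinality where

  open import Data.Fin.Subset using (_-_; ∣_∣; inside; outside)
  open import Data.Fin.Subset.Properties
    using (nonempty?; Empty-unique; ∣⊥∣≡0; p─⊥≡p; x∈p∧x≢y⇒x∈p-y; x∈p⇒∣p-x∣<∣p∣; p─q⊆p)

  x∉p-x : ∀ {n} {p : Subset n} {x} → ¬ (x ∈ p - x)
  x∉p-x {p = _ ∷ p} {suc x} (Vec.there x∈p-x) = x∉p-x {p = p} x∈p-x

  ∣p∣≡1+∣p-x∣ : ∀ {n} {p : Subset n} {x} → x ∈ p → ∣ p ∣ ≡ suc ∣ p - x ∣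
  ∣p∣≡1+∣p-x∣ {p = inside ∷ p} {zero} _ = cong (λ q → suc ∣ q ∣) (sym (p─⊥≡p p))
  ∣p∣≡1+∣p-x∣ {p = inside ∷ p} {suc x} (Vec.there x∈p) = cong suc (∣p∣≡1+∣p-x∣ x∈p)
  ∣p∣≡1+∣p-x∣ {p = outside ∷ p} {suc x} (Vec.there x∈p) = ∣p∣≡1+∣p-x∣ x∈p

  module _ {m n} {f : Fin m → Fin n} (f-injective : Injective _≡_ _≡_ f) where

    ∣p∣≤∣q∣-by-injection : ∀ {p q} → (∀ {x} → x ∈ p → f x ∈ q) → ∣ p ∣ ≤ ∣ q ∣
    ∣p∣≤∣q∣-by-injection {p} = go ∣ p ∣ refl
      where
      go : ∀ k {p q} → ∣ p ∣ ≡ k → (∀ {x} → x ∈ p → f x ∈ q) → ∣ p ∣ ≤ ∣ q ∣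
      go zero ∣p∣≡0 _ = subst (_≤ _) (sym ∣p∣≡0) z≤n
      go (suc k) {p} {q} ∣p∣≡1+k p⇒q with nonempty? p
      ... | no p-empty =
        contradiction (trans (sym ∣p∣≡1+k) (trans (cong ∣_∣ (Empty-unique p-empty)) (∣⊥∣≡0 m))) ℕ.1+n≢0
      ... | yes (x , x∈p) =
        subst₂ _≤_ (sym (∣p∣≡1+∣p-x∣ x∈p)) (sym (∣p∣≡1+∣p-x∣ (p⇒q x∈p)))
          (s≤s (go k (ℕ.suc-injective (trans (sym (∣p∣≡1+∣p-x∣ x∈p)) ∣p∣≡1+k)) p-x⇒q-fx))
        where
        p-x⇒q-fx : ∀ {y} → y ∈ p - x → f y ∈ q - f x
        p-x⇒q-fx y∈p-x = x∈p∧x≢y⇒x∈p-y (p⇒q (p─q⊆p p _ y∈p-x))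
          (λ fy≡fx → x∉p-x (subst (_∈ p - x) (f-injective fy≡fx) y∈p-x))

  3≤∣p∣ : ∀ {n} {p : Subset n} {x y z} → x ∈ p → y ∈ p → z ∈ p → x ≢ y → x ≢ z → y ≢ z
        → 3 ≤ ∣ p ∣
  3≤∣p∣ {p = p} {x} {y} {z} x∈p y∈p z∈p x≢y x≢z y≢z =
    ℕ.<-≤-trans (s≤s (ℕ.<-≤-trans (s≤s (ℕ.<-≤-trans (s≤s z≤n) (x∈p⇒∣p-x∣<∣p∣ z∈p-x-y)))
                                  (x∈p⇒∣p-x∣<∣p∣ y∈p-x)))
                (x∈p⇒∣p-x∣<∣p∣ x∈p)
    where
    y∈p-x : y ∈ p - x
    y∈p-x = x∈p∧x≢y⇒x∈p-y y∈p (x≢y ∘ sym)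
    z∈p-x-y : z ∈ p - x - y
    z∈p-x-y = x∈p∧x≢y⇒x∈p-y (x∈p∧x≢y⇒x∈p-y z∈p (x≢z ∘ sym)) (y≢z ∘ sym)

open SubsetCardinality

Image-GraphEq : ∀ {N} {f g : Fin N → Fin N} {G H : Fin N → Fin N → Set} → (∀ a → f (g a) ≡ a)
              → (∀ {u v} → G u v → H (f u) (f v)) → (∀ {u v} → H (f u) (f v) → G u v)
              → GraphEq (Image f G) H
Image-GraphEq {f = f} {g} {H = H} f∘g≗id G⇒H H⇒G a b = forth , back
  where
  forth : Image f _ a b → H a b
  forth (u , v , e , refl , refl) = G⇒H e
  back : H a b → Image f _ a b
  back h = g a , g b , H⇒G (subst₂ H (sym (f∘g≗id a)) (sym (f∘g≗id b)) h) , f∘g≗id a , f∘g≗id b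

module ModularArithmetic where

  open import Data.Integer using (ℤ; +_; -_; _+_; _-_; _*_; 0ℤ; 1ℤ)
  import Data.Integer as ℤ
  import Data.Integer.Properties as ℤ
  open import Data.Integer.Divisibility.Signed
  open import Data.Nat.DivMod using (m≡m%n+[m/n]*n)
  open import Relation.Binary.Definitions using (tri<; tri≈; tri>)
  open import Data.Integer.DivMod using (_%ℕ_; _/ℕ_; a≡a%ℕn+[a/ℕn]*n; n%ℕd<d)
  open import Data.Integer.Tactic.RingSolver using (solve-∀)
  open import Relation.Binary.Bundles using (Setoid)

  private
    variable
      a b c e k m : ℤ

  infix 4 _≡_mod_ _≡±_mod_

  record _≡_mod_ (a b m : ℤ) : Set where
    constructor congruent
    field
      modulus∣difference : m ∣ a - b

  ≡-mod-refl : a ≡ a mod m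
  ≡-mod-refl {a} = congruent (divides 0ℤ (ℤ.+-inverseʳ a))

  ≡-mod-reflexive : a ≡ b → a ≡ b mod m
  ≡-mod-reflexive refl = ≡-mod-refl

  ≡-mod-sym : a ≡ b mod m → b ≡ a mod m
  ≡-mod-sym {a} {b} (congruent m∣a-b) = congruent (subst (_ ∣_) (negate-difference a b) (∣m⇒∣-m m∣a-b))
    where
    negate-difference : ∀ a b → - (a - b) ≡ b - a
    negate-difference = solve-∀

  ≡-mod-trans : a ≡ b mod m → b ≡ c mod m → a ≡ c mod m
  ≡-mod-trans {a} {b} {c = c} (congruent m∣a-b) (congruent m∣b-c) =
    congruent (subst (_ ∣_) (telescope a b c) (∣m∣n⇒∣m+n m∣a-b m∣b-c))
    where
    telescope : ∀ a b c → (a - b) + (b - c) ≡ a - c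
    telescope = solve-∀

  ≡-mod-setoid : ℤ → Setoid _ _
  ≡-mod-setoid m = record
    { Carrier = ℤ
    ; _≈_ = _≡_mod m
    ; isEquivalence = record { refl = ≡-mod-refl ; sym = ≡-mod-sym ; trans = ≡-mod-trans }
    }

  module ≡-mod-Reasoning (m : ℤ) = Relation.Binary.Reasoning.Setoid (≡-mod-setoid m)

  ≡-mod-weaken : k ∣ m → a ≡ b mod m → a ≡ b mod k
  ≡-mod-weaken k∣m (congruent m∣a-b) = congruent (∣-trans k∣m m∣a-b)

  ∣-resp-≡-mod : a ≡ b mod m → m ∣ a → m ∣ b
  ∣-resp-≡-mod {a} {b} (congruent m∣a-b) m∣a = subst (_ ∣_) (cancel a b) (∣m∣n⇒∣m-n m∣a m∣a-b)
    where
    cancel : ∀ a b → a - (a - b) ≡ b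
    cancel = solve-∀

  +-cong-mod : a ≡ b mod m → c ≡ e mod m → a + c ≡ b + e mod m
  +-cong-mod {a} {b} {c = c} {e} (congruent m∣a-b) (congruent m∣c-e) =
    congruent (subst (_ ∣_) (regroup a b c e) (∣m∣n⇒∣m+n m∣a-b m∣c-e))
    where
    regroup : ∀ a b c e → (a - b) + (c - e) ≡ (a + c) - (b + e)
    regroup = solve-∀

  -‿cong-mod : a ≡ b mod m → - a ≡ - b mod m
  -‿cong-mod {a} {b} (congruent m∣a-b) = congruent (subst (_ ∣_) (regroup a b) (∣m⇒∣-m m∣a-b))
    where
    regroup : ∀ a b → - (a - b) ≡ - a - - b
    regroup = solve-∀

  -cong-mod : a ≡ b mod m → c ≡ e mod m → a - c ≡ b - e mod m
  -cong-mod a≡b c≡e = +-cong-mod a≡b (-‿cong-mod c≡e)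

  ≡-neg⇒neg-≡ : a ≡ - b mod m → - a ≡ b mod m
  ≡-neg⇒neg-≡ {b = b} a≡-b = ≡-mod-trans (-‿cong-mod a≡-b) (≡-mod-reflexive (ℤ.neg-involutive b))

  neg-≡⇒≡-neg : - a ≡ b mod m → a ≡ - b mod m
  neg-≡⇒≡-neg {a} -a≡b = ≡-mod-trans (≡-mod-reflexive (sym (ℤ.neg-involutive a))) (-‿cong-mod -a≡b)

  +-absorbʳ-mod : m ∣ b → a + b ≡ a mod m
  +-absorbʳ-mod {m} {b} {a} m∣b = congruent (subst (m ∣_) (cancel a b) m∣b)
    where
    cancel : ∀ a b → b ≡ (a + b) - a
    cancel = solve-∀

  +-absorbˡ-mod : m ∣ b → b + a ≡ a mod m
  +-absorbˡ-mod {b = b} {a} m∣b = subst (_≡ a mod _) (ℤ.+-comm a b) (+-absorbʳ-mod m∣b)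

  *-congˡ-mod : a ≡ b mod m → c * a ≡ c * b mod m
  *-congˡ-mod {a} {b} {c = c} (congruent m∣a-b) =
    congruent (subst (_ ∣_) (distrib c a b) (∣n⇒∣m*n c m∣a-b))
    where
    distrib : ∀ c a b → c * (a - b) ≡ c * a - c * b
    distrib = solve-∀

  *-congʳ-mod : a ≡ b mod m → a * c ≡ b * c mod m
  *-congʳ-mod {a} {b} {c = c} a≡b =
    subst₂ (_≡_mod _) (ℤ.*-comm c a) (ℤ.*-comm c b) (*-congˡ-mod {c = c} a≡b)

  *-cong-mod : a ≡ b mod m → k ∣ c → a * c ≡ b * c mod (m * k)
  *-cong-mod {a} {b} {m} {k} {c} (congruent (divides q a-b≡qm)) (divides r c≡rk) =
    congruent (divides (q * r) (begin
      a * c - b * c      ≡⟨ distrib a b c ⟩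
      (a - b) * c        ≡⟨ cong₂ _*_ a-b≡qm c≡rk ⟩
      (q * m) * (r * k)  ≡⟨ interchange q m r k ⟩
      (q * r) * (m * k)  ∎))
    where
    open ≡-Reasoning
    distrib : ∀ a b c → a * c - b * c ≡ (a - b) * c
    distrib = solve-∀
    interchange : ∀ q m r k → (q * m) * (r * k) ≡ (q * r) * (m * k)
    interchange = solve-∀

  *-cancelʳ-mod : ∀ k .{{_ : ℤ.NonZero k}} → a * k ≡ b * k mod (m * k) → a ≡ b mod m
  *-cancelʳ-mod {a} {b} k (congruent mk∣ak-bk) =
    congruent (*-cancelʳ-∣ k (subst (_ ∣_) (distrib a b k) mk∣ak-bk))
    where
    distrib : ∀ a b k → a * k - b * k ≡ (a - b) * k
    distrib = solve-∀

  prime-∣-* : ∀ {p} → Prime p → + p ∣ a * b → + p ∣ a ⊎ + p ∣ b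
  prime-∣-* {a} {b} {p} p-prime p∣ab =
    Sum.map ∣ᵤ⇒∣ ∣ᵤ⇒∣
      (euclidsLemma ℤ.∣ a ∣ ℤ.∣ b ∣ p-prime (subst (p ℕ.∣_) (ℤ.abs-* a b) (∣⇒∣ᵤ p∣ab)))

  +[a+q*m]≡+a : ∀ a q m → + (a ℕ.+ q ℕ.* m) ≡ + a mod + m
  +[a+q*m]≡+a a q m =
    subst (_≡ + a mod + m) (sym (ℤ.pos-+ a (q ℕ.* m))) (+-absorbʳ-mod (divides (+ q) (ℤ.pos-* q m)))

  %-≡-mod : ∀ a m .{{_ : NonZero m}} → + a ≡ + (a % m) mod + m
  %-≡-mod a m =
    subst (λ e → + e ≡ + (a % m) mod + m) (sym (m≡m%n+[m/n]*n a m)) (+[a+q*m]≡+a (a % m) (a / m) m)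

  %ℕ-≡-mod : ∀ w m .{{_ : NonZero m}} → w ≡ + (w %ℕ m) mod + m
  %ℕ-≡-mod w m =
    subst (_≡ + (w %ℕ m) mod + m) (sym (a≡a%ℕn+[a/ℕn]*n w m)) (+-absorbʳ-mod (divides (w /ℕ m) refl))

  private
    residues-apart : ∀ {m r s} → r < s → s < m → ¬ (+ r ≡ + s mod + m)
    residues-apart {m} {r} {s} r<s s<m (congruent m∣r-s) =
      ℕ.>⇒∤ {{ℕ.>-nonZero (ℕ.m<n⇒0<n∸m r<s)}} (ℕ.≤-<-trans (ℕ.m∸n≤m s r) s<m)
        (subst (m ℕ.∣_) (trans (cong ℤ.∣_∣ (ℤ.[+m]-[+n]≡m⊖n r s)) (ℤ.∣⊖∣-< r<s))
                        (∣⇒∣ᵤ m∣r-s))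

  ≡-mod⇒≡ : ∀ {m r s} → r < m → s < m → + r ≡ + s mod + m → r ≡ s
  ≡-mod⇒≡ {r = r} {s} r<m s<m r≡s with ℕ.<-cmp r s
  ... | tri< r<s _ _ = contradiction r≡s (residues-apart r<s s<m)
  ... | tri≈ _ r≡s _ = r≡s
  ... | tri> _ _ s<r = contradiction (≡-mod-sym r≡s) (residues-apart s<r r<m)

  residue-reduced : ∀ {m a} → a < m → + m ∣ + a → + a ≡ 0ℤ
  residue-reduced {m} {a} a<m m∣a =
    cong +_ (≡-mod⇒≡ a<m (ℕ.≤-<-trans z≤n a<m)
                     (congruent (subst (+ m ∣_) (sym (ℤ.+-identityʳ (+ a))) m∣a)))

  residue-difference-reduced : ∀ {m a b} → a < m → b < m → + m ∣ + a - + b → + a - + b ≡ 0ℤ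
  residue-difference-reduced {a = a} a<m b<m m∣a-b with ≡-mod⇒≡ a<m b<m (congruent m∣a-b)
  ... | refl = ℤ.+-inverseʳ (+ a)

  ≡-mod-lift : ∀ m .{{_ : NonZero m}} {w c M} → w ≡ c mod M
             → ∃ λ k → k < m × w ≡ c + + k * M mod (+ m * M)
  ≡-mod-lift m {w} {c} {M} (congruent (divides q w-c≡qM)) =
    q%m , n%ℕd<d q m , congruent (divides q/m (begin
    w - (c + + q%m * M)                    ≡⟨ regroup w c (+ q%m) M ⟩
    (w - c) - + q%m * M                    ≡⟨ cong (_- + q%m * M) w-c≡qM ⟩
    q * M - + q%m * M                      ≡⟨ cong (λ q → q * M - + q%m * M) (a≡a%ℕn+[a/ℕn]*n q m) ⟩
    (+ q%m + q/m * + m) * M - + q%m * M    ≡⟨ cancel (+ q%m) q/m (+ m) M ⟩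
    q/m * (+ m * M)                        ∎))
    where
    open ≡-Reasoning
    q%m : ℕ
    q%m = q %ℕ m
    q/m : ℤ
    q/m = q /ℕ m
    regroup : ∀ w c k M → w - (c + k * M) ≡ (w - c) - k * M
    regroup = solve-∀
    cancel : ∀ k r m M → (k + r * m) * M - k * M ≡ r * (m * M)
    cancel = solve-∀

  data _≡±_mod_ (a b m : ℤ) : Set where
    plus  : a ≡ b mod m → a ≡± b mod m
    minus : a ≡ - b mod m → a ≡± b mod m

  ≡-mod-≡±-trans : a ≡ b mod m → b ≡± c mod m → a ≡± c mod m
  ≡-mod-≡±-trans a≡b (plus b≡c) = plus (≡-mod-trans a≡b b≡c)
  ≡-mod-≡±-trans a≡b (minus b≡-c) = minus (≡-mod-trans a≡b b≡-c)

  ≡±-sym : a ≡± b mod m → b ≡± a mod m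
  ≡±-sym (plus a≡b) = plus (≡-mod-sym a≡b)
  ≡±-sym (minus a≡-b) = minus (≡-mod-sym (≡-neg⇒neg-≡ a≡-b))

  ≡±-trans : a ≡± b mod m → b ≡± c mod m → a ≡± c mod m
  ≡±-trans (plus a≡b) b≡±c = ≡-mod-≡±-trans a≡b b≡±c
  ≡±-trans (minus a≡-b) (plus b≡c) = minus (≡-mod-trans a≡-b (-‿cong-mod b≡c))
  ≡±-trans (minus a≡-b) (minus b≡-c) = plus (≡-mod-trans a≡-b (≡-neg⇒neg-≡ b≡-c))

  *-congʳ-≡± : a ≡± b mod m → a * c ≡± b * c mod m
  *-congʳ-≡± (plus a≡b) = plus (*-congʳ-mod a≡b)
  *-congʳ-≡± {b = b} {c = c} (minus a≡-b) =
    minus (subst (_ ≡_mod _) (sym (ℤ.neg-distribˡ-* b c)) (*-congʳ-mod a≡-b))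

  *-cancelʳ-≡± : ∀ k .{{_ : ℤ.NonZero k}} → a * k ≡± b * k mod (m * k) → a ≡± b mod m
  *-cancelʳ-≡± k (plus ak≡bk) = plus (*-cancelʳ-mod k ak≡bk)
  *-cancelʳ-≡± {b = b} k (minus ak≡-bk) =
    minus (*-cancelʳ-mod k (subst (_ ≡_mod _) (ℤ.neg-distribˡ-* b k) ak≡-bk))

  ≡±-∣ : k ∣ m → k ∣ b → a ≡± b mod m → k ∣ a
  ≡±-∣ k∣m k∣b (plus a≡b) = ∣-resp-≡-mod (≡-mod-sym (≡-mod-weaken k∣m a≡b)) k∣b
  ≡±-∣ k∣m k∣b (minus a≡-b) = ∣-resp-≡-mod (≡-mod-sym (≡-mod-weaken k∣m a≡-b)) (∣m⇒∣-m k∣b)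

open ModularArithmetic

module Θ-Properties (N p : ℕ) {{N≢0 : NonZero N}} {{p≢0 : NonZero p}} (p∣N : p ℕ.∣ N) where

  open import Data.Integer using (ℤ; +_; _+_; _*_)
  import Data.Integer.Properties as ℤ
  open import Data.Integer.Divisibility.Signed using (divides; ∣ᵤ⇒∣; ∣n⇒∣m*n)
  open import Data.Integer.Tactic.RingSolver using (solve-∀)
  open import Data.Nat.DivMod using (m%n<n)
  open import Data.Nat.GCD using (gcd; gcd[m,n]∣n; gcd-greatest)
  open import Data.Fin.Properties using (toℕ-fromℕ<; toℕ-injective; toℕ<n)

  gcd[N,p]≡p : gcd N p ≡ p
  gcd[N,p]≡p = ℕ.∣-antisym (gcd[m,n]∣n N p) (gcd-greatest p∣N ℕ.∣-refl)

  -- gcd N p sits under an instance argument in Θ, so it is abstracted before being replaced by p.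
  toℕ-Θ : ∀ t u → toℕ (Θ N p t u) ≡ (toℕ u ℕ.+ toℕ u % p ℕ.* t ℕ.* p) % N
  toℕ-Θ t u = trans (toℕ-fromℕ< _) (with-gcd (gcd N p) gcd[N,p]≡p {{gcd-nonZero N p}})
    where
    with-gcd : ∀ g → g ≡ p → .{{_ : NonZero g}}
             → (toℕ u ℕ.+ toℕ u % g ℕ.* t ℕ.* g) % N ≡ (toℕ u ℕ.+ toℕ u % p ℕ.* t ℕ.* p) % N
    with-gcd g refl = refl

  Θ-≡-mod : ∀ t u → + toℕ (Θ N p t u) ≡ + toℕ u + + (toℕ u % p) * + (t ℕ.* p) mod + N
  Θ-≡-mod t u = begin
    + toℕ (Θ N p t u)                ≡⟨ cong +_ (toℕ-Θ t u) ⟩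
    + ((U ℕ.+ a ℕ.* t ℕ.* p) % N)    ≈⟨ %-≡-mod (U ℕ.+ a ℕ.* t ℕ.* p) N ⟨
    + (U ℕ.+ a ℕ.* t ℕ.* p)          ≡⟨ ℤ.pos-+ U (a ℕ.* t ℕ.* p) ⟩
    + U + + (a ℕ.* t ℕ.* p)          ≡⟨ cong (λ e → + U + + e) (ℕ.*-assoc a t p) ⟩
    + U + + (a ℕ.* (t ℕ.* p))        ≡⟨ cong (_+_ (+ U)) (ℤ.pos-* a (t ℕ.* p)) ⟩
    + U + + a * + (t ℕ.* p)          ∎
    where
    open ≡-mod-Reasoning (+ N)
    U a : ℕ
    U = toℕ u
    a = toℕ u % p

  Θ-%-invariant : ∀ t u → toℕ (Θ N p t u) % p ≡ toℕ u % p
  Θ-%-invariant t u = ≡-mod⇒≡ (m%n<n _ p) (m%n<n _ p) (begin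
    + (toℕ (Θ N p t u) % p)      ≈⟨ %-≡-mod (toℕ (Θ N p t u)) p ⟨
    + toℕ (Θ N p t u)            ≈⟨ ≡-mod-weaken (∣ᵤ⇒∣ p∣N) (Θ-≡-mod t u) ⟩
    + U + + a * + (t ℕ.* p)      ≈⟨ +-absorbʳ-mod (∣n⇒∣m*n (+ a) (∣ᵤ⇒∣ (ℕ.divides t refl))) ⟩
    + U                          ≈⟨ %-≡-mod U p ⟩
    + (U % p)                    ∎)
    where
    open ≡-mod-Reasoning (+ p)
    U a : ℕ
    U = toℕ u
    a = toℕ u % p

  Θ-cancel : ∀ s t u → N ℕ.∣ (s ℕ.+ t) ℕ.* p → Θ N p s (Θ N p t u) ≡ u
  Θ-cancel s t u N∣[s+t]p = toℕ-injective (≡-mod⇒≡ (toℕ<n (Θ N p s (Θ N p t u))) (toℕ<n u) (begin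
    + toℕ (Θ N p s (Θ N p t u))                      ≈⟨ Θ-≡-mod s (Θ N p t u) ⟩
    + toℕ (Θ N p t u) + + (toℕ (Θ N p t u) % p) * S
      ≡⟨ cong (λ r → + toℕ (Θ N p t u) + + r * S) (Θ-%-invariant t u) ⟩
    + toℕ (Θ N p t u) + + a * S                      ≈⟨ +-cong-mod (Θ-≡-mod t u) ≡-mod-refl ⟩
    (+ U + + a * T) + + a * S                        ≡⟨ collect (+ U) (+ a) S T ⟩
    + U + + a * (S + T)                              ≡⟨ cong (λ e → + U + + a * e) S+T≡[s+t]p ⟩
    + U + + a * + ((s ℕ.+ t) ℕ.* p)
      ≈⟨ +-absorbʳ-mod (∣n⇒∣m*n (+ a) (∣ᵤ⇒∣ N∣[s+t]p)) ⟩
    + U                                              ∎))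
    where
    open ≡-mod-Reasoning (+ N)
    U a : ℕ
    U = toℕ u
    a = toℕ u % p
    S T : ℤ
    S = + (s ℕ.* p)
    T = + (t ℕ.* p)
    S+T≡[s+t]p : S + T ≡ + ((s ℕ.+ t) ℕ.* p)
    S+T≡[s+t]p = trans (sym (ℤ.pos-+ (s ℕ.* p) (t ℕ.* p))) (cong +_ (sym (ℕ.*-distribʳ-+ p s t)))
    collect : ∀ U a S T → (U + a * T) + a * S ≡ U + a * (S + T)
    collect = solve-∀

module Residues (N : ℕ) {{N≢0 : NonZero N}} where

  open import Data.Integer using (ℤ; +_)
  open import Data.Integer.DivMod using (_%ℕ_; n%ℕd<d)
  open import Data.Nat.DivMod using (m<n⇒m%n≡m)
  open import Data.Fin.Properties using (toℕ-fromℕ<; toℕ-injective; toℕ<n)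

  toℕ-res : ∀ w → toℕ (res N w) ≡ w %ℕ N
  toℕ-res w = trans (toℕ-fromℕ< _) (m<n⇒m%n≡m (n%ℕd<d w N))

  ≡-mod-res : ∀ w → w ≡ + toℕ (res N w) mod + N
  ≡-mod-res w = subst (λ r → w ≡ + r mod + N) (sym (toℕ-res w)) (%ℕ-≡-mod w N)

  res-cong : ∀ {a b} → a ≡ b mod + N → res N a ≡ res N b
  res-cong {a} {b} a≡b = toℕ-injective (≡-mod⇒≡ (toℕ<n (res N a)) (toℕ<n (res N b))
    (≡-mod-trans (≡-mod-sym (≡-mod-res a)) (≡-mod-trans a≡b (≡-mod-res b))))

  res-injective : ∀ {a b} → res N a ≡ res N b → a ≡ b mod + N
  res-injective {a} {b} ra≡rb =
    ≡-mod-trans (≡-mod-res a) (subst (λ r → + toℕ r ≡ b mod + N) (sym ra≡rb) (≡-mod-sym (≡-mod-res b)))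

  res-toℕ : ∀ u → res N (+ toℕ u) ≡ u
  res-toℕ u = toℕ-injective (trans (toℕ-res (+ toℕ u)) (m<n⇒m%n≡m (toℕ<n u)))

module Construction (p n x y : ℕ) {{p-prime : Prime p}} {{n≢0 : NonZero n}} where

  open import Data.Integer using (ℤ; +_; -_; _+_; _-_; _*_; 0ℤ; 1ℤ)
  import Data.Integer.Properties as ℤ
  open import Data.Integer.Divisibility.Signed
    using (_∣_; divides; ∣ᵤ⇒∣; ∣⇒∣ᵤ; ∣n⇒∣m*n; ∣m⇒∣-m; ∣-refl; ∣-trans; *-cancelʳ-∣)
  open import Data.Integer.Tactic.RingSolver using (solve-∀)
  import Data.Nat.Tactic.RingSolver as ℕ-Solver
  open import Data.Nat.DivMod using (m≡m%n+[m/n]*n; [m+n]%n≡m%n; m<n⇒m%n≡m; m*n/n≡m; m%n<n)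
  open import Data.Nat.Primality using (prime⇒nonZero; prime⇒nonTrivial)
  open import Data.Nat.GCD using (gcd)
  open import Data.Nat.Coprimality using (Coprime)
  import Data.Fin.Subset as Subset
  open import Data.List using (map; upTo)
  open import Data.List.Relation.Unary.Any.Properties
    using (map⁺; map⁻; ++⁺ˡ; ++⁺ʳ; ++⁻; applyUpTo⁺; applyUpTo⁻)
  import Data.List.Relation.Unary.Any as Any

  instance
    p≢0 : NonZero p
    p≢0 = prime⇒nonZero p-prime
    N≢0 : NonZero (n ℕ.* p ^ 3)
    N≢0 = npc-nz p n

  -- The ring solver does not see through _^_ on ℕ, so the solver lemmas below
  -- spell p ^ k out as p * (… * (p * 1)), which is what it unfolds to.
  N M : ℕ
  N = n ℕ.* p ^ 3
  M = n ℕ.* p ^ 2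

  instance
    M≢0 : NonZero M
    M≢0 = ℕ.m*n≢0 n (p ^ 2) {{n≢0}} {{ℕ.m^n≢0 p 2}}

  N≡M*p : N ≡ M ℕ.* p
  N≡M*p = reassociate n p
    where
    reassociate : ∀ n p → n ℕ.* (p ℕ.* (p ℕ.* (p ℕ.* 1))) ≡ n ℕ.* (p ℕ.* (p ℕ.* 1)) ℕ.* p
    reassociate = ℕ-Solver.solve-∀

  +N≡p*M : + N ≡ + p * + M
  +N≡p*M = trans (cong +_ (trans N≡M*p (ℕ.*-comm M p))) (ℤ.pos-* p M)

  +M≡p*np : + M ≡ + p * + (n ℕ.* p)
  +M≡p*np = trans (cong +_ (reassociate n p)) (ℤ.pos-* p (n ℕ.* p))
    where
    reassociate : ∀ n p → n ℕ.* (p ℕ.* (p ℕ.* 1)) ≡ p ℕ.* (n ℕ.* p)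
    reassociate = ℕ-Solver.solve-∀

  p∣M : + p ∣ + M
  p∣M = divides (+ (n ℕ.* p)) (trans +M≡p*np (ℤ.*-comm (+ p) _))

  M∣N : + M ∣ + N
  M∣N = divides (+ p) +N≡p*M

  p∣N : + p ∣ + N
  p∣N = ∣-trans p∣M M∣N

  p∣np : + p ∣ + (n ℕ.* p)
  p∣np = ∣ᵤ⇒∣ (ℕ.divides n refl)

  δ : ℕ → ℤ
  δ i = + d p n x y i

  δ≡x : ∀ i → δ i ≡ + x mod + p
  δ≡x i = subst (λ e → + e ≡ + x mod + p) (sym (regroup (i ∸ 1) x p n y))
                (+[a+q*m]≡+a x ((i ∸ 1) ℕ.* x ℕ.* n ℕ.+ y) p)
    where
    regroup : ∀ c x p n y
            → c ℕ.* x ℕ.* p ℕ.* n ℕ.+ x ℕ.+ y ℕ.* p ≡ x ℕ.+ (c ℕ.* x ℕ.* n ℕ.+ y) ℕ.* p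
    regroup = ℕ-Solver.solve-∀

  K : ℕ → ℤ
  K j = + (j ℕ.* n ℕ.* p)

  np∣K : ∀ j → + (n ℕ.* p) ∣ K j
  np∣K j = ∣ᵤ⇒∣ (ℕ.divides j (ℕ.*-assoc j n p))

  δ-step : ∀ c j → δ (wrap p (suc c ℕ.+ j)) ≡ δ (suc c) + + x * K j mod + M
  δ-step c j = ≡-mod-sym (begin
    δ (suc c) + + x * K j                       ≡⟨ cast ⟩
    + (d p n x y (suc c) ℕ.+ x ℕ.* (j ℕ.* n ℕ.* p))
      ≡⟨ cong +_ (wrap-around) ⟩
    + (d p n x y (wrap p (suc c ℕ.+ j)) ℕ.+ q ℕ.* x ℕ.* M)
      ≈⟨ +[a+q*m]≡+a (d p n x y (wrap p (suc c ℕ.+ j))) (q ℕ.* x) M ⟩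
    δ (wrap p (suc c ℕ.+ j))                    ∎)
    where
    open ≡-mod-Reasoning (+ M)
    k q : ℕ
    k = (c ℕ.+ j) % p
    q = (c ℕ.+ j) / p
    cast : δ (suc c) + + x * K j ≡ + (d p n x y (suc c) ℕ.+ x ℕ.* (j ℕ.* n ℕ.* p))
    cast = sym (trans (ℤ.pos-+ (d p n x y (suc c)) _) (cong (_+_ (δ (suc c))) (ℤ.pos-* x _)))
    collect : ∀ c j x p n y → c ℕ.* x ℕ.* p ℕ.* n ℕ.+ x ℕ.+ y ℕ.* p ℕ.+ x ℕ.* (j ℕ.* n ℕ.* p)
                            ≡ (c ℕ.+ j) ℕ.* x ℕ.* p ℕ.* n ℕ.+ x ℕ.+ y ℕ.* p
    collect = ℕ-Solver.solve-∀
    split : ∀ k q x p n y → (k ℕ.+ q ℕ.* p) ℕ.* x ℕ.* p ℕ.* n ℕ.+ x ℕ.+ y ℕ.* p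
                          ≡ k ℕ.* x ℕ.* p ℕ.* n ℕ.+ x ℕ.+ y ℕ.* p
                            ℕ.+ q ℕ.* x ℕ.* (n ℕ.* (p ℕ.* (p ℕ.* 1)))
    split = ℕ-Solver.solve-∀
    wrap-around : d p n x y (suc c) ℕ.+ x ℕ.* (j ℕ.* n ℕ.* p)
                ≡ d p n x y (wrap p (suc c ℕ.+ j)) ℕ.+ q ℕ.* x ℕ.* M
    wrap-around = trans (collect c j x p n y)
      (trans (cong (λ e → e ℕ.* x ℕ.* p ℕ.* n ℕ.+ x ℕ.+ y ℕ.* p) (m≡m%n+[m/n]*n (c ℕ.+ j) p))
             (split k q x p n y))

  InR : ℤ → ℤ → Set
  InR e w = w ≡± + p mod + N ⊎ w ≡± e mod + M

  module Shift {L : ℤ} (np∣L : + (n ℕ.* p) ∣ L) {e e′ : ℤ}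
               (e≡x : e ≡ + x mod + p) (e′≡e+xL : e′ ≡ e + + x * L mod + M) where

    private
      shift-≡ : ∀ {D c W} → D ≡ c mod + p → W ≡ D + c * L mod + M → D ≡ e mod + M → W ≡ e′ mod + M
      shift-≡ {D} {c} {W} D≡c W≡D+cL D≡e = begin
        W            ≈⟨ W≡D+cL ⟩
        D + c * L    ≈⟨ +-cong-mod D≡e cL≡xL ⟩
        e + + x * L  ≈⟨ e′≡e+xL ⟨
        e′           ∎
        where
        open ≡-mod-Reasoning (+ M)
        c≡x : c ≡ + x mod + p
        c≡x = ≡-mod-trans (≡-mod-sym D≡c) (≡-mod-trans (≡-mod-weaken p∣M D≡e) e≡x)
        cL≡xL : c * L ≡ + x * L mod + M
        cL≡xL = subst (c * L ≡ + x * L mod_) (sym +M≡p*np) (*-cong-mod c≡x np∣L)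

    InR-shift : ∀ {c D W} → (+ p ∣ c → c ≡ 0ℤ) → D ≡ c mod + p → W ≡ D + c * L mod + N
              → InR e D → InR e′ W
    InR-shift {c} {D} {W} p∣c⇒c≡0 D≡c W≡D+cL (inj₁ D≡±p) = inj₁ (≡-mod-≡±-trans W≡D D≡±p)
      where
      p∣c : + p ∣ c
      p∣c = ∣-resp-≡-mod D≡c (≡±-∣ p∣N ∣-refl D≡±p)
      W≡D : W ≡ D mod + N
      W≡D = ≡-mod-trans W≡D+cL (≡-mod-reflexive (begin
        D + c * L   ≡⟨ cong (λ c → D + c * L) (p∣c⇒c≡0 p∣c) ⟩
        D + 0ℤ      ≡⟨ ℤ.+-identityʳ D ⟩
        D           ∎))
        where open ≡-Reasoning
    InR-shift _ D≡c W≡D+cL (inj₂ (plus D≡e)) =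
      inj₂ (plus (shift-≡ D≡c (≡-mod-weaken M∣N W≡D+cL) D≡e))
    InR-shift {c} {D} {W} _ D≡c W≡D+cL (inj₂ (minus D≡-e)) =
      inj₂ (minus (neg-≡⇒≡-neg (shift-≡ (-‿cong-mod D≡c) -W≡-D-cL (≡-neg⇒neg-≡ D≡-e))))
      where
      negate : ∀ D c L → - (D + c * L) ≡ - D + - c * L
      negate = solve-∀
      -W≡-D-cL : - W ≡ - D + - c * L mod + M
      -W≡-D-cL = subst (- W ≡_mod + M) (negate D c L) (-‿cong-mod (≡-mod-weaken M∣N W≡D+cL))

  open Shift using (InR-shift)

  InR-unshift : ∀ {L} → + (n ℕ.* p) ∣ L → ∀ {e e′} → e ≡ + x mod + p → e′ ≡ e + + x * L mod + M
              → ∀ {c D W} → (+ p ∣ c → c ≡ 0ℤ) → D ≡ c mod + p → W ≡ D + c * L mod + N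
              → InR e′ W → InR e D
  InR-unshift {L} np∣L {e} {e′} e≡x e′≡e+xL {c} {D} {W} p∣c⇒c≡0 D≡c W≡D+cL =
    InR-shift (∣m⇒∣-m np∣L) e′≡x e≡e′-xL p∣c⇒c≡0 W≡c D≡W-cL
    where
    p∣L : + p ∣ L
    p∣L = ∣-trans p∣np np∣L
    undo : ∀ z c L → z ≡ (z + c * L) + c * - L
    undo = solve-∀
    e′≡x : e′ ≡ + x mod + p
    e′≡x = ≡-mod-trans (≡-mod-weaken p∣M e′≡e+xL)
                       (≡-mod-trans (+-absorbʳ-mod (∣n⇒∣m*n (+ x) p∣L)) e≡x)
    e≡e′-xL : e ≡ e′ + + x * - L mod + M
    e≡e′-xL = ≡-mod-trans (≡-mod-reflexive (undo e (+ x) L)) (+-cong-mod (≡-mod-sym e′≡e+xL) ≡-mod-refl)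
    W≡c : W ≡ c mod + p
    W≡c = ≡-mod-trans (≡-mod-weaken p∣N W≡D+cL) (≡-mod-trans (+-absorbʳ-mod (∣n⇒∣m*n c p∣L)) D≡c)
    D≡W-cL : D ≡ W + c * - L mod + N
    D≡W-cL = ≡-mod-trans (≡-mod-reflexive (undo D c L)) (+-cong-mod (≡-mod-sym W≡D+cL) ≡-mod-refl)

  open Residues N

  Rlist-∈⁻ : ∀ {i w} → Any (w ≡_mod + N) (Rlist p n x y i) → InR (δ i) w
  Rlist-∈⁻ (here w≡p) = inj₁ (plus w≡p)
  Rlist-∈⁻ {i} {w} (there w∈) with ++⁻ (map (λ k → + (d p n x y i ℕ.+ k ℕ.* M)) (upTo p)) w∈
  ... | inj₁ w∈₁ with applyUpTo⁻ (λ k → k) (map⁻ w∈₁)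
  ...   | k , _ , w≡δ+kM =
    inj₂ (plus (≡-mod-trans (≡-mod-weaken M∣N w≡δ+kM) (+[a+q*m]≡+a (d p n x y i) k M)))
  Rlist-∈⁻ {i} {w} (there w∈) | inj₂ w∈₂ with ++⁻ (map (λ k → + (suc k ℕ.* M) - δ i) (upTo p)) w∈₂
  ... | inj₁ w∈₃ with applyUpTo⁻ (λ k → k) (map⁻ w∈₃)
  ...   | k , _ , w≡[k+1]M-δ =
    inj₂ (minus (≡-mod-trans (≡-mod-weaken M∣N w≡[k+1]M-δ)
                             (+-absorbˡ-mod (divides (+ suc k) (ℤ.pos-* (suc k) M)))))
  Rlist-∈⁻ (there w∈) | inj₂ w∈₂ | inj₂ (here w≡N-p) =
    inj₁ (minus (≡-mod-trans w≡N-p (+-absorbˡ-mod ∣-refl)))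

  ≡-mod-M⇒Any : ∀ {w c} (f : ℕ → ℤ) → (∀ k → c + + k * + M ≡ f k) → w ≡ c mod + M
              → Any (w ≡_mod + N) (map f (upTo p))
  ≡-mod-M⇒Any {w} {c} f c+kM≡fk w≡c = from-lift (≡-mod-lift p w≡c)
    where
    from-lift : (∃ λ k → k < p × w ≡ c + + k * + M mod (+ p * + M)) → Any (w ≡_mod + N) (map f (upTo p))
    from-lift (k , k<p , w≡c+kM) =
      map⁺ (applyUpTo⁺ (λ k → k) (subst₂ (w ≡_mod_) (c+kM≡fk k) (sym +N≡p*M) w≡c+kM) k<p)

  Rlist-∈⁺ : ∀ {i w} → InR (δ i) w → Any (w ≡_mod + N) (Rlist p n x y i)
  Rlist-∈⁺ (inj₁ (plus w≡p)) = here w≡p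
  Rlist-∈⁺ {i} (inj₁ (minus w≡-p)) =
    there (++⁺ʳ (map (λ k → + (d p n x y i ℕ.+ k ℕ.* M)) (upTo p))
          (++⁺ʳ (map (λ k → + (suc k ℕ.* M) - δ i) (upTo p))
          (here (≡-mod-trans w≡-p (≡-mod-sym (+-absorbˡ-mod ∣-refl))))))
  Rlist-∈⁺ {i} (inj₂ (plus w≡δ)) = there (++⁺ˡ (≡-mod-M⇒Any _ cast w≡δ))
    where
    cast : ∀ k → δ i + + k * + M ≡ + (d p n x y i ℕ.+ k ℕ.* M)
    cast k = sym (trans (ℤ.pos-+ (d p n x y i) (k ℕ.* M)) (cong (_+_ (δ i)) (ℤ.pos-* k M)))
  Rlist-∈⁺ {i} (inj₂ (minus w≡-δ)) =
    there (++⁺ʳ (map (λ k → + (d p n x y i ℕ.+ k ℕ.* M)) (upTo p))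
          (++⁺ˡ (≡-mod-M⇒Any _ cast (≡-mod-trans w≡-δ (≡-mod-sym (+-absorbˡ-mod ∣-refl))))))
    where
    regroup : ∀ m e k → (m - e) + k * m ≡ (m + k * m) - e
    regroup = solve-∀
    cast : ∀ k → (+ M - δ i) + + k * + M ≡ + (suc k ℕ.* M) - δ i
    cast k = trans (regroup (+ M) (δ i) (+ k))
                   (cong (_- δ i) (sym (trans (ℤ.pos-+ M (k ℕ.* M)) (cong (_+_ (+ M)) (ℤ.pos-* k M)))))

  Rset-∈⁻ : ∀ {i w} → res N w ∈ Rset p n x y i → InR (δ i) w
  Rset-∈⁻ {i} w∈ = Rlist-∈⁻ {i} (Any.map res-injective (∈-image⁻ (res N) (Rlist p n x y i) w∈))

  Rset-∈⁺ : ∀ {i w} → InR (δ i) w → res N w ∈ Rset p n x y i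
  Rset-∈⁺ {i} w∈ = ∈-image⁺ (res N) (Rlist p n x y i) (Any.map res-cong (Rlist-∈⁺ {i} w∈))

  open Θ-Properties N p (∣⇒∣ᵤ p∣N)

  module Θ-Shift (c j : ℕ) where

    i i′ t : ℕ
    i = suc c
    i′ = wrap p (suc c ℕ.+ j)
    t = j ℕ.* n

    Θ-difference : ∀ u v → + toℕ (Θ N p t u) - + toℕ (Θ N p t v)
                         ≡ (+ toℕ u - + toℕ v) + (+ (toℕ u % p) - + (toℕ v % p)) * K j mod + N
    Θ-difference u v =
      ≡-mod-trans (-cong-mod (Θ-≡-mod t u) (Θ-≡-mod t v))
                  (≡-mod-reflexive (regroup (+ toℕ u) (+ toℕ v) (+ (toℕ u % p)) (+ (toℕ v % p)) (K j)))
      where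
      regroup : ∀ U V a b L → (U + a * L) - (V + b * L) ≡ (U - V) + (a - b) * L
      regroup = solve-∀

    difference-% : ∀ (u v : Fin N) → + toℕ u - + toℕ v ≡ + (toℕ u % p) - + (toℕ v % p) mod + p
    difference-% u v = -cong-mod (%-≡-mod (toℕ u) p) (%-≡-mod (toℕ v) p)

    Circ-Θ⁺ : ∀ {u v : Fin N} → Circ N (Rset p n x y i) u v
            → Circ N (Rset p n x y i′) (Θ N p t u) (Θ N p t v)
    Circ-Θ⁺ {u} {v} uv∈ = Rset-∈⁺ {i′} (InR-shift (np∣K j) (δ≡x i) (δ-step c j)
      (residue-difference-reduced (m%n<n (toℕ u) p) (m%n<n (toℕ v) p))
      (difference-% u v) (Θ-difference u v) (Rset-∈⁻ {i} uv∈))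

    Circ-Θ⁻ : ∀ {u v : Fin N} → Circ N (Rset p n x y i′) (Θ N p t u) (Θ N p t v)
            → Circ N (Rset p n x y i) u v
    Circ-Θ⁻ {u} {v} ΘuΘv∈ = Rset-∈⁺ {i} (InR-unshift (np∣K j) (δ≡x i) (δ-step c j)
      (residue-difference-reduced (m%n<n (toℕ u) p) (m%n<n (toℕ v) p))
      (difference-% u v) (Θ-difference u v) (Rset-∈⁻ {i′} ΘuΘv∈))

    Θ-∈ : ∀ {u : Fin N} → u ∈ Rset p n x y i → Θ N p t u ∈ Rset p n x y i′
    Θ-∈ {u} u∈ = subst (_∈ Rset p n x y i′) (res-toℕ (Θ N p t u))
      (Rset-∈⁺ {i′} (InR-shift (np∣K j) (δ≡x i) (δ-step c j)
        (residue-reduced (m%n<n (toℕ u) p)) (%-≡-mod (toℕ u) p) (Θ-≡-mod t u)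
        (Rset-∈⁻ {i} (subst (_∈ Rset p n x y i) (sym (res-toℕ u)) u∈))))

    s : ℕ
    s = (M ∸ 1) ℕ.* t

    N∣[s+t]p : N ℕ.∣ (s ℕ.+ t) ℕ.* p
    N∣[s+t]p = ℕ.divides t (begin
      ((M ∸ 1) ℕ.* t ℕ.+ t) ℕ.* p   ≡⟨ cong (ℕ._* p) (pred-multiple M t) ⟩
      M ℕ.* t ℕ.* p                 ≡⟨ regroup M t p ⟩
      t ℕ.* (M ℕ.* p)               ≡⟨ cong (t ℕ.*_) (sym N≡M*p) ⟩
      t ℕ.* N                       ∎)
      where
      open ≡-Reasoning
      pred-multiple : ∀ m t → .{{NonZero m}} → (m ∸ 1) ℕ.* t ℕ.+ t ≡ m ℕ.* t
      pred-multiple (suc m) t = ℕ.+-comm (m ℕ.* t) t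
      regroup : ∀ m t p → m ℕ.* t ℕ.* p ≡ t ℕ.* (m ℕ.* p)
      regroup = ℕ-Solver.solve-∀

    Θ-rightInverse : ∀ a → Θ N p t (Θ N p s a) ≡ a
    Θ-rightInverse a = Θ-cancel t s a (subst (λ e → N ℕ.∣ e ℕ.* p) (ℕ.+-comm s t) N∣[s+t]p)

    Θ-injective : Injective _≡_ _≡_ (Θ N p t)
    Θ-injective {u} {v} Θu≡Θv =
      trans (sym (Θ-cancel s t u N∣[s+t]p)) (trans (cong (Θ N p s) Θu≡Θv) (Θ-cancel s t v N∣[s+t]p))

    Θ-GraphEq : GraphEq (Image (Θ N p t) (Circ N (Rset p n x y i))) (Circ N (Rset p n x y i′))
    Θ-GraphEq = Image-GraphEq Θ-rightInverse Circ-Θ⁺ Circ-Θ⁻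

  1<p : 1 < p
  1<p = ℕ.nonTrivial⇒n>1 p {{prime⇒nonTrivial p-prime}}

  wrap-+-∸ : ∀ {i j} → i ≤ p → 1 ≤ j → j ≤ p → wrap p (i ℕ.+ (j ℕ.+ p ∸ i)) ≡ j
  wrap-+-∸ {i} {suc j′} i≤p _ j≤p = begin
    wrap p (i ℕ.+ (suc j′ ℕ.+ p ∸ i))  ≡⟨ cong (wrap p) (ℕ.m+[n∸m]≡n (ℕ.≤-trans i≤p (ℕ.m≤n+m p _))) ⟩
    suc ((j′ ℕ.+ p) % p)               ≡⟨ cong suc ([m+n]%n≡m%n j′ p) ⟩
    suc (j′ % p)                       ≡⟨ cong suc (m<n⇒m%n≡m j≤p) ⟩
    suc j′                             ∎
    where open ≡-Reasoning

  N/gcd[N,p]≡M : (N / gcd N p) {{gcd-nonZero N p}} ≡ M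
  N/gcd[N,p]≡M = with-gcd (gcd N p) gcd[N,p]≡p {{gcd-nonZero N p}}
    where
    with-gcd : ∀ g → g ≡ p → .{{_ : NonZero g}} → N / g ≡ M
    with-gcd g refl = trans (cong (_/ p) N≡M*p) (m*n/n≡m M p)

  shift-bounds : ∀ {i j} → 1 ≤ i → i ≤ p → 1 ≤ j → j ≤ p
               → 1 ≤ (j ℕ.+ p ∸ i) ℕ.* n
               × (j ℕ.+ p ∸ i) ℕ.* n ≤ (N / gcd N p) {{gcd-nonZero N p}} ∸ 1
  shift-bounds {i} {j} 1≤i i≤p 1≤j j≤p =
    1≤en , subst (λ m → e ℕ.* n ≤ m ∸ 1) (sym N/gcd[N,p]≡M) (ℕ.<⇒≤pred en<M)
    where
    e : ℕ
    e = j ℕ.+ p ∸ i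
    1≤e : 1 ≤ e
    1≤e = ℕ.≤-trans 1≤j (subst (_≤ e) (ℕ.m+n∸n≡m j p) (ℕ.∸-monoʳ-≤ (j ℕ.+ p) i≤p))
    1≤en : 1 ≤ e ℕ.* n
    1≤en = ℕ.*-mono-≤ 1≤e (ℕ.>-nonZero⁻¹ n)
    e<p+p : e < p ℕ.+ p
    e<p+p = ℕ.≤-<-trans (ℕ.∸-monoˡ-≤ i (ℕ.+-monoˡ-≤ p j≤p))
                        (ℕ.∸-monoʳ-< {p ℕ.+ p} 1≤i (ℕ.≤-trans i≤p (ℕ.m≤n+m p p)))
    p+p≤p*p : p ℕ.+ p ≤ p ℕ.* p
    p+p≤p*p = subst (_≤ p ℕ.* p) (cong (p ℕ.+_) (ℕ.+-identityʳ p)) (ℕ.*-monoˡ-≤ p 1<p)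
    reassociate : ∀ n p → p ℕ.* p ℕ.* n ≡ n ℕ.* (p ℕ.* (p ℕ.* 1))
    reassociate = ℕ-Solver.solve-∀
    en<M : e ℕ.* n < M
    en<M = subst (e ℕ.* n <_) (reassociate n p) (ℕ.*-monoˡ-< n (ℕ.<-≤-trans e<p+p p+p≤p*p))

  module Type2-Facts (p-odd : ¬ (2 ℕ.∣ p)) (1≤x : 1 ≤ x) (x<p : x < p) where

    p∤x : ¬ (+ p ∣ + x)
    p∤x p∣x = ℕ.>⇒∤ {{ℕ.>-nonZero 1≤x}} x<p (∣⇒∣ᵤ p∣x)

    p∤δ : ∀ i → ¬ (+ p ∣ δ i)
    p∤δ i p∣δ = p∤x (∣-resp-≡-mod (δ≡x i) p∣δ)

    x≢-x : ¬ (+ x ≡ - + x mod + p)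
    x≢-x (congruent p∣x--x) =
      Sum.[ p∤2 , p∤x ]′ (prime-∣-* {+ 2} {+ x} p-prime (subst (+ p ∣_) (double (+ x)) p∣x--x))
      where
      double : ∀ a → a - - a ≡ + 2 * a
      double = solve-∀
      p∤2 : ¬ (+ p ∣ + 2)
      p∤2 p∣2 = p-odd (subst (2 ℕ.∣_) (ℕ.≤-antisym 1<p (ℕ.∣⇒≤ (∣⇒∣ᵤ p∣2))) ℕ.∣-refl)

    δ≢-δ : ∀ i j → ¬ (δ i ≡ - δ j mod + p)
    δ≢-δ i j δi≡-δj = x≢-x (begin
      + x    ≈⟨ δ≡x i ⟨
      δ i    ≈⟨ δi≡-δj ⟩
      - δ j  ≈⟨ -‿cong-mod (δ≡x j) ⟩
      - + x  ∎)
      where open ≡-mod-Reasoning (+ p)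

    δ-form : ∀ c → δ (suc c) ≡ + c * (+ x * + (n ℕ.* p)) + + (x ℕ.+ y ℕ.* p)
    δ-form c = trans (cong +_ (regroup c x p n y))
      (trans (ℤ.pos-+ (c ℕ.* (x ℕ.* (n ℕ.* p))) (x ℕ.+ y ℕ.* p))
             (cong (_+ + (x ℕ.+ y ℕ.* p)) (trans (ℤ.pos-* c _) (cong (+ c *_) (ℤ.pos-* x (n ℕ.* p))))))
      where
      regroup : ∀ c x p n y
              → c ℕ.* x ℕ.* p ℕ.* n ℕ.+ x ℕ.+ y ℕ.* p ≡ c ℕ.* (x ℕ.* (n ℕ.* p)) ℕ.+ (x ℕ.+ y ℕ.* p)
      regroup = ℕ-Solver.solve-∀

    δ-apart : ∀ {i j} → 1 ≤ i → i ≤ p → 1 ≤ j → j ≤ p → i ≢ j → ¬ (δ i ≡± δ j mod + M)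
    δ-apart {suc ci} {suc cj} _ ci<p _ cj<p i≢j (plus (congruent M∣δi-δj)) =
      Sum.[ (λ p∣ci-cj → i≢j (cong suc (≡-mod⇒≡ ci<p cj<p (congruent p∣ci-cj)))) , p∤x ]′
        (prime-∣-* {+ ci - + cj} {+ x} p-prime
                   (*-cancelʳ-∣ (+ (n ℕ.* p)) {{ℕ.m*n≢0 n p}} p*np∣[ci-cj]x*np))
      where
      difference : ∀ c c′ x m b → (c * (x * m) + b) - (c′ * (x * m) + b) ≡ ((c - c′) * x) * m
      difference = solve-∀
      p*np∣[ci-cj]x*np : + p * + (n ℕ.* p) ∣ ((+ ci - + cj) * + x) * + (n ℕ.* p)
      p*np∣[ci-cj]x*np = subst₂ _∣_ +M≡p*np
        (trans (cong₂ _-_ (δ-form ci) (δ-form cj))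
               (difference (+ ci) (+ cj) (+ x) (+ (n ℕ.* p)) (+ (x ℕ.+ y ℕ.* p))))
        M∣δi-δj
    δ-apart {i} {j} _ _ _ _ _ (minus δi≡-δj) = δ≢-δ i j (≡-mod-weaken p∣M δi≡-δj)

    InR-unit : ∀ {e w} → ¬ (+ p ∣ w) → InR e w → w ≡± e mod + M
    InR-unit p∤w (inj₁ w≡±p) = contradiction (≡±-∣ p∣N ∣-refl w≡±p) p∤w
    InR-unit p∤w (inj₂ w≡±e) = w≡±e

    InR-multiple : ∀ {i w} → + p ∣ w → InR (δ i) w → w ≡± + p mod + N
    InR-multiple p∣w (inj₁ w≡±p) = w≡±p
    InR-multiple {i} p∣w (inj₂ w≡±δ) = contradiction (≡±-∣ p∣M p∣w (≡±-sym w≡±δ)) (p∤δ i)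

    δ∈Rset : ∀ i → res N (δ i) ∈ Rset p n x y i
    δ∈Rset i = Rset-∈⁺ {i} (inj₂ (plus ≡-mod-refl))

    Rset-≢ : ∀ {i j} → 1 ≤ i → i ≤ p → 1 ≤ j → j ≤ p → i ≢ j
           → Rset p n x y i ≢ Rset p n x y j
    Rset-≢ {i} {j} 1≤i i≤p 1≤j j≤p i≢j Ri≡Rj = δ-apart 1≤i i≤p 1≤j j≤p i≢j
      (InR-unit (p∤δ i) (Rset-∈⁻ {j} (subst (res N (δ i) ∈_) Ri≡Rj (δ∈Rset i))))

    3≤∣Rset∣ : ∀ i → 3 ≤ Subset.∣ Rset p n x y i ∣
    3≤∣Rset∣ i =
      3≤∣p∣ (Rset-∈⁺ {i} (inj₁ (plus ≡-mod-refl))) (δ∈Rset i) (Rset-∈⁺ {i} (inj₂ (minus ≡-mod-refl)))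
      (λ rp≡rδ → p∤δ i (≡±-∣ p∣N ∣-refl (plus (≡-mod-sym (res-injective rp≡rδ)))))
      (λ rp≡r-δ → p∤δ i (≡±-∣ p∣N ∣-refl (minus (neg-≡⇒≡-neg (≡-mod-sym (res-injective rp≡r-δ))))))
      (λ rδ≡r-δ → δ≢-δ i i (≡-mod-weaken p∣N (res-injective rδ≡r-δ)))

    ∣Rset∣-≤ : ∀ {i j} → 1 ≤ i → i ≤ p → 1 ≤ j → j ≤ p
             → Subset.∣ Rset p n x y i ∣ ≤ Subset.∣ Rset p n x y j ∣
    ∣Rset∣-≤ {suc ci} {j} _ i≤p 1≤j j≤p = ∣p∣≤∣q∣-by-injection Θ-injective
      (λ {u} u∈ → subst (λ k → Θ N p t u ∈ Rset p n x y k) (wrap-+-∸ i≤p 1≤j j≤p) (Θ-∈ u∈))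
      where open Θ-Shift ci (j ℕ.+ p ∸ suc ci)

    not-scaled : ∀ {i j} → 1 ≤ i → i ≤ p → 1 ≤ j → j ≤ p → i ≢ j → ∀ a → Coprime a N
               → ¬ (∀ s → (s ∈ Rset p n x y j → InScaled N a (Rset p n x y i) s)
                        × (InScaled N a (Rset p n x y i) s → s ∈ Rset p n x y j))
    not-scaled {i} {j} 1≤i i≤p 1≤j j≤p i≢j a a⊥N Rj≡aRi =
      δ-apart 1≤i i≤p 1≤j j≤p i≢j (≡±-trans (≡±-sym aδi≡±δi) aδi≡±δj)
      where
      scaled-InR : ∀ {w} → InR (δ i) w → InR (δ j) (+ a * w)
      scaled-InR {w} w∈ = Rset-∈⁻ {j} (subst (_∈ Rset p n x y j) (res-cong scaled)
        (proj₂ (Rj≡aRi (res N (+ (a ℕ.* toℕ (res N w))))) (res N w , Rset-∈⁺ {i} w∈ , refl)))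
        where
        scaled : + (a ℕ.* toℕ (res N w)) ≡ + a * w mod + N
        scaled = subst (_≡ + a * w mod + N) (sym (ℤ.pos-* a (toℕ (res N w))))
                       (*-congˡ-mod {c = + a} (≡-mod-sym (≡-mod-res w)))
      p∤a : ¬ (+ p ∣ + a)
      p∤a p∣a = ℕ.<-irrefl (sym (a⊥N (∣⇒∣ᵤ p∣a , ∣⇒∣ᵤ p∣N))) 1<p
      a≡±1 : + a ≡± 1ℤ mod + M
      a≡±1 = *-cancelʳ-≡± (+ p)
        (subst₂ (λ b m → + a * + p ≡± b mod m) (sym (ℤ.*-identityˡ (+ p))) (trans +N≡p*M (ℤ.*-comm (+ p) (+ M)))
                (InR-multiple {j} (∣n⇒∣m*n (+ a) ∣-refl) (scaled-InR (inj₁ (plus ≡-mod-refl)))))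
      aδi≡±δi : + a * δ i ≡± δ i mod + M
      aδi≡±δi = subst (+ a * δ i ≡±_mod + M) (ℤ.*-identityˡ (δ i)) (*-congʳ-≡± a≡±1)
      aδi≡±δj : + a * δ i ≡± δ j mod + M
      aδi≡±δj =
        InR-unit (Sum.[ p∤a , p∤δ i ]′ ∘ prime-∣-* p-prime) (scaled-InR (inj₂ (plus ≡-mod-refl)))

    type2 : ∀ {i j} → 1 ≤ i → i ≤ p → 1 ≤ j → j ≤ p → i ≢ j
          → Type2 N p (Rset p n x y i) (Rset p n x y j)
    type2 {suc c} {j} 1≤i i≤p 1≤j j≤p i≢j =
        Rset-≢ 1≤i i≤p 1≤j j≤p i≢j
      , ℕ.≤-antisym (∣Rset∣-≤ 1≤i i≤p 1≤j j≤p) (∣Rset∣-≤ 1≤j j≤p 1≤i i≤p)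
      , 3≤∣Rset∣ (suc c)
      , subst (1 <_) (sym gcd[N,p]≡p) 1<p
      , ( t , proj₁ (shift-bounds 1≤i i≤p 1≤j j≤p) , proj₂ (shift-bounds 1≤i i≤p 1≤j j≤p)
        , subst (λ k → GraphEq (Image (Θ N p t) (Circ N (Rset p n x y (suc c)))) (Circ N (Rset p n x y k)))
                (wrap-+-∸ i≤p 1≤j j≤p) Θ-GraphEq)
      , not-scaled 1≤i i≤p 1≤j j≤p i≢j
      where open Θ-Shift c (j ℕ.+ p ∸ suc c) using (t; Θ-GraphEq)

  Θ-Rset-GraphEq : ∀ {i} j → 1 ≤ i
                 → GraphEq (Image (Θ N p (j ℕ.* n)) (Circ N (Rset p n x y i)))
                           (Circ N (Rset p n x y (wrap p (i ℕ.+ j))))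
  Θ-Rset-GraphEq {suc c} j _ = Θ-Shift.Θ-GraphEq c j

open import Data.Nat using (_+_; _*_)
open import Data.Nat.Divisibility using (_∣_)

theorem2p1 : (p n x y : ℕ) → {{hp : Prime p}} → ¬ (2 ∣ p) → {{hn : NonZero n}}
             → 1 ≤ x → x ≤ p ∸ 1 → y ≤ n * p ∸ 1
             → 1 ≤ x + y * p → x + y * p ≤ n * p ^ 2 ∸ 1
             → ((i j : ℕ) → 1 ≤ i → i ≤ p → 1 ≤ j → j ≤ p
                 → GraphEq (Image (Θ (n * p ^ 3) {{npc-nz p n}} p (j * n)) (Circ (n * p ^ 3) {{npc-nz p n}} (Rset p n x y i)))
                           (Circ (n * p ^ 3) {{npc-nz p n}} (Rset p n x y (wrap p (i + j)))))
             × ((i j : ℕ) → 1 ≤ i → i ≤ p → 1 ≤ j → j ≤ p → i ≢ j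
                 → Type2 (n * p ^ 3) {{npc-nz p n}} p (Rset p n x y i) (Rset p n x y j))
theorem2p1 p n x y p-odd 1≤x x≤p∸1 _ _ _ =
    (λ i j 1≤i _ _ _ → Θ-Rset-GraphEq j 1≤i)
  , (λ i j → type2)
  where
  open Construction p n x y
  x<p : x < p
  x<p = subst (_≤ p) (ℕ.+-comm x 1) (ℕ.m≤o∸n⇒m+n≤o x (ℕ.<⇒≤ 1<p) x≤p∸1)
  open Type2-Facts p-odd 1≤x x<p
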